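{- For every positive integer $n$, \[ \phi(n) \geq \frac{n}{\lfloor \log_2(n) \rfloor + 1}, \] where $\phi$ is Euler's totient function. -}

module Defs where

open import Data.Nat using (ℕ; suc)
open import Data.Nat.GCD using (gcd)
open import Data.Nat.Properties using (_≟_)
open import Data.List using (List; length; filter; upTo; map)
open import Relation.Binary.PropositionalEquality using (_≡_)

φ : ℕ → ℕ
φ n = length (filter (λ k → gcd k n ≟ 1) (map suc (upTo n)))

-- If n has r distinct prime factors then 2 ^ r ≤ n, and since the i-th smallest of them
-- is at least i + 1, φ n / n = ∏ (1 − 1/pᵢ) ≥ ∏ (1 − 1/(i + 1)) = 1/(r + 1).  Formally one
-- inducts on a bound b + 1 for the prime factors of n: multiplying k by p = b + 2 multiplies
-- φ k by p when p ∣ k, and by p − 1 when p ∤ k; in the latter case r grows by one, and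
-- p (r + 1) ≤ (p − 1) (r + 2) holds because r ≤ b.  Both identities for φ come from counting
-- the residues coprime to k in the p blocks of length k that make up 1, …, p k.
module Submission where

open import Defs
open import Data.Nat using (ℕ; _+_; _*_; _≤_; _>_)
open import Data.Nat.Logarithm using (⌊log₂_⌋; ⌊log₂⌋-mono-≤; ⌊log₂[2^n]⌋≡n)
open import Data.Nat.Base
  using (zero; suc; _^_; _<_; z≤n; s≤s; z<s; s<s; NonZero; >-nonZero; >-nonZero⁻¹; nonTrivial⇒≢1; nonTrivial⇒n>1)
open import Data.Nat.Properties
open import Data.Nat.Divisibility
open import Data.Nat.Coprimality using (Coprime; coprime?; gcd≡1⇒coprime; coprime⇒gcd≡1; coprime-+; coprime-divisor)
  renaming (sym to coprime-sym)
open import Data.Nat.Primality using (Prime; prime?; prime⇒irreducible; prime⇒nonTrivial; prime⇒nonZero)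
open import Data.Nat.Primality.Factorisation using (factorise)
open import Data.Nat.GCD using (gcd)
open import Data.Nat.Induction using (<-rec)
open import Data.Nat.ListAction using (product)
open import Data.Nat.Tactic.RingSolver using (solve-∀)
open import Data.List.Base using ([]; _∷_; length; filter; applyUpTo; map; upTo)
open import Data.List.Properties using (map-upTo)
open import Data.List.Relation.Unary.All using (_∷_)
open import Data.Product using (_×_; _,_)
open import Data.Sum using (inj₁; inj₂)
open import Function using (_∘_)
open import Relation.Nullary using (Dec; yes; no; ¬_)
open import Relation.Nullary.Decidable using (_×-dec_)
open import Relation.Nullary.Negation using (contradiction)
open import Relation.Unary using (Pred; Decidable)
open import Relation.Binary.PropositionalEquality

∑ : ℕ → (ℕ → ℕ) → ℕ
∑ zero    f = 0
∑ (suc n) f = f 0 + ∑ n (f ∘ suc)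

syntax ∑ n (λ j → e) = ∑[ j < n ] e

∑-cong : ∀ n {f g} → (∀ j → f j ≡ g j) → ∑ n f ≡ ∑ n g
∑-cong zero    f≗g = refl
∑-cong (suc n) f≗g = cong₂ _+_ (f≗g 0) (∑-cong n (f≗g ∘ suc))

∑-+ : ∀ m n f → ∑ (m + n) f ≡ ∑ m f + ∑[ j < n ] f (m + j)
∑-+ zero    n f = refl
∑-+ (suc m) n f = trans (cong (f 0 +_) (∑-+ m n (f ∘ suc))) (sym (+-assoc (f 0) _ _))

∑-distrib-+ : ∀ n f g → ∑[ j < n ] (f j + g j) ≡ ∑ n f + ∑ n g
∑-distrib-+ zero    f g = refl
∑-distrib-+ (suc n) f g = begin
  (f 0 + g 0) + ∑[ j < n ] (f (suc j) + g (suc j))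
    ≡⟨ cong ((f 0 + g 0) +_) (∑-distrib-+ n (f ∘ suc) (g ∘ suc)) ⟩
  (f 0 + g 0) + (∑ n (f ∘ suc) + ∑ n (g ∘ suc))
    ≡⟨ +-interchange (f 0) (g 0) _ _ ⟩
  (f 0 + ∑ n (f ∘ suc)) + (g 0 + ∑ n (g ∘ suc)) ∎
  where
  open ≡-Reasoning
  +-interchange : ∀ a b x y → (a + b) + (x + y) ≡ (a + x) + (b + y)
  +-interchange = solve-∀

∑-periodic : ∀ m q f → (∀ j → f (m + j) ≡ f j) → ∑ (q * m) f ≡ q * ∑ m f
∑-periodic m zero    f periodic = refl
∑-periodic m (suc q) f periodic = begin
  ∑ (m + q * m) f                   ≡⟨ ∑-+ m (q * m) f ⟩
  ∑ m f + ∑[ j < q * m ] f (m + j)  ≡⟨ cong (∑ m f +_) (∑-cong (q * m) periodic) ⟩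
  ∑ m f + ∑ (q * m) f               ≡⟨ cong (∑ m f +_) (∑-periodic m q f periodic) ⟩
  ∑ m f + q * ∑ m f                 ∎
  where open ≡-Reasoning

∑-last : ∀ n f → (∀ j → j < n → f j ≡ 0) → ∑ (suc n) f ≡ f n
∑-last zero    f _      = +-identityʳ (f 0)
∑-last (suc n) f vanish =
  cong₂ _+_ (vanish 0 z<s) (∑-last n (f ∘ suc) (λ j j<n → vanish (suc j) (s<s j<n)))

∑-multiples : ∀ p .{{_ : NonZero p}} q (f : ℕ → ℕ) → (∀ y → ¬ p ∣ y → f y ≡ 0) →
              ∑[ j < q * p ] f (suc j) ≡ ∑[ t < q ] f (suc t * p)
∑-multiples p         zero    f vanish = refl
∑-multiples p@(suc p′) (suc q) f vanish = begin
  ∑[ j < p + q * p ] f (suc j)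
    ≡⟨ ∑-+ p (q * p) (f ∘ suc) ⟩
  ∑[ j < p ] f (suc j) + ∑[ j < q * p ] f (suc (p + j))
    ≡⟨ cong₂ _+_ (∑-last p′ (f ∘ suc) (λ j j<p′ → vanish (suc j) (p∤suc j<p′)))
                 (∑-cong (q * p) (λ j → cong f (sym (+-suc p j)))) ⟩
  f p + ∑[ j < q * p ] f (p + suc j)
    ≡⟨ cong₂ _+_ (cong f (sym (*-identityˡ p)))
                 (∑-multiples p q (f ∘ (p +_)) (λ y p∤y → vanish (p + y) (λ p∣p+y → p∤y (∣m+n∣m⇒∣n p∣p+y ∣-refl)))) ⟩
  f (1 * p) + ∑[ t < q ] f (suc (suc t) * p) ∎
  where
  open ≡-Reasoning
  p∤suc : ∀ {j} → j < p′ → ¬ p ∣ suc j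
  p∤suc j<p′ p∣1+j = <⇒≱ (s<s j<p′) (∣⇒≤ p∣1+j)

indicator : ∀ {ℓ} {P : Set ℓ} → Dec P → ℕ
indicator (yes _) = 1
indicator (no  _) = 0

indicator-cong : ∀ {ℓ ℓ′} {P : Set ℓ} {Q : Set ℓ′} → (P → Q) → (Q → P) →
                 (P? : Dec P) (Q? : Dec Q) → indicator P? ≡ indicator Q?
indicator-cong _   _   (yes _)  (yes _)  = refl
indicator-cong _   _   (no _)   (no _)   = refl
indicator-cong P⇒Q _   (yes p)  (no ¬q)  = contradiction (P⇒Q p) ¬q
indicator-cong _   Q⇒P (no ¬p)  (yes q)  = contradiction (Q⇒P q) ¬p

indicator-no : ∀ {ℓ} {P : Set ℓ} → ¬ P → (P? : Dec P) → indicator P? ≡ 0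
indicator-no ¬p (yes p) = contradiction p ¬p
indicator-no ¬p (no _)  = refl

length-filter-applyUpTo : ∀ {ℓ} {P : Pred ℕ ℓ} (P? : Decidable P) f n →
                          length (filter P? (applyUpTo f n)) ≡ ∑[ j < n ] indicator (P? (f j))
length-filter-applyUpTo P? f zero = refl
length-filter-applyUpTo P? f (suc n) with P? (f 0)
... | yes _ = cong suc (length-filter-applyUpTo P? (f ∘ suc) n)
... | no  _ = length-filter-applyUpTo P? (f ∘ suc) n

χ : ℕ → ℕ → ℕ
χ m x = indicator (coprime? x m)

χ-cong : ∀ {m x k y} → (Coprime x m → Coprime y k) → (Coprime y k → Coprime x m) → χ m x ≡ χ k y
χ-cong ⇒ ⇐ = indicator-cong ⇒ ⇐ _ _

φ≡∑χ : ∀ n → φ n ≡ ∑[ j < n ] χ n (suc j)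
φ≡∑χ n = begin
  length (filter gcd[-,n]≟1 (map suc (upTo n)))    ≡⟨ cong (length ∘ filter gcd[-,n]≟1) (map-upTo suc n) ⟩
  length (filter gcd[-,n]≟1 (applyUpTo suc n))     ≡⟨ length-filter-applyUpTo gcd[-,n]≟1 suc n ⟩
  ∑[ j < n ] indicator (gcd[-,n]≟1 (suc j))         ≡⟨ ∑-cong n (λ _ → indicator-cong gcd≡1⇒coprime coprime⇒gcd≡1 _ _) ⟩
  ∑[ j < n ] χ n (suc j)                            ∎
  where
  open ≡-Reasoning
  gcd[-,n]≟1 : Decidable (λ k → gcd k n ≡ 1)
  gcd[-,n]≟1 k = gcd k n ≟ 1

coprime-∣ˡ : ∀ {d m n} → d ∣ m → Coprime m n → Coprime d n
coprime-∣ˡ d∣m m⊥n (e∣d , e∣n) = m⊥n (∣-trans e∣d d∣m , e∣n)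

coprime-∣ʳ : ∀ {d m n} → d ∣ n → Coprime m n → Coprime m d
coprime-∣ʳ d∣n = coprime-sym ∘ coprime-∣ˡ d∣n ∘ coprime-sym

coprime-*ʳ : ∀ {m n o} → Coprime m n → Coprime m o → Coprime m (n * o)
coprime-*ʳ m⊥n m⊥o (d∣m , d∣n*o) = m⊥o (d∣m , coprime-divisor (coprime-∣ˡ d∣m m⊥n) d∣n*o)

prime∤⇒coprime : ∀ {p x} → Prime p → ¬ p ∣ x → Coprime x p
prime∤⇒coprime pr p∤x (d∣x , d∣p) with prime⇒irreducible pr d∣p
... | inj₁ d≡1    = d≡1
... | inj₂ refl   = contradiction d∣x p∤x

χ-periodic : ∀ m y → χ m (m + y) ≡ χ m y
χ-periodic m y = χ-cong (λ m+y⊥m (d∣y , d∣m) → m+y⊥m (∣m∣n⇒∣m+n d∣m d∣y , d∣m)) coprime-+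

∑χ-periodic : ∀ m q → ∑[ j < q * m ] χ m (suc j) ≡ q * φ m
∑χ-periodic m q = begin
  ∑[ j < q * m ] χ m (suc j)  ≡⟨ ∑-periodic m q (χ m ∘ suc) χ[1+m+j]≡χ[1+j] ⟩
  q * ∑[ j < m ] χ m (suc j)  ≡⟨ cong (q *_) (φ≡∑χ m) ⟨
  q * φ m                     ∎
  where
  open ≡-Reasoning
  χ[1+m+j]≡χ[1+j] : ∀ j → χ m (suc (m + j)) ≡ χ m (suc j)
  χ[1+m+j]≡χ[1+j] j = trans (cong (χ m) (sym (+-suc m j))) (χ-periodic m (suc j))

φ[m*n]≡m*φ[n] : ∀ m n → m ∣ n → φ (m * n) ≡ m * φ n
φ[m*n]≡m*φ[n] m n m∣n = begin
  φ (m * n)                        ≡⟨ φ≡∑χ (m * n) ⟩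
  ∑[ j < m * n ] χ (m * n) (suc j) ≡⟨ ∑-cong (m * n) (λ _ → χ-cong (coprime-∣ʳ (n∣m*n m))
                                                                   (λ x⊥n → coprime-*ʳ (coprime-∣ʳ m∣n x⊥n) x⊥n)) ⟩
  ∑[ j < m * n ] χ n (suc j)       ≡⟨ ∑χ-periodic n m ⟩
  m * φ n                          ∎
  where open ≡-Reasoning

-- Among 1, …, p n the residues coprime to n but not to p n are exactly the multiples t p
-- with t ≤ n coprime to n, and there are φ n of them.
φ[p*n]+φ[n]≡p*φ[n] : ∀ p n → Prime p → ¬ p ∣ n → φ (p * n) + φ n ≡ p * φ n
φ[p*n]+φ[n]≡p*φ[n] p n pr p∤n = sym (begin
  p * φ n                                                ≡⟨ ∑χ-periodic n p ⟨
  ∑[ j < p * n ] χ n (suc j)                             ≡⟨ ∑-cong (p * n) (χ-split ∘ suc) ⟩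
  ∑[ j < p * n ] (χ (p * n) (suc j) + χ∣p (suc j))       ≡⟨ ∑-distrib-+ (p * n) _ _ ⟩
  ∑[ j < p * n ] χ (p * n) (suc j) + ∑[ j < p * n ] χ∣p (suc j)
                                                         ≡⟨ cong₂ _+_ (sym (φ≡∑χ (p * n))) ∑χ∣p≡φ[n] ⟩
  φ (p * n) + φ n                                        ∎)
  where
  open ≡-Reasoning
  instance
    p≢0 : NonZero p
    p≢0 = prime⇒nonZero pr

  p≢1 : p ≢ 1
  p≢1 = nonTrivial⇒≢1 {{prime⇒nonTrivial pr}}

  χ∣p : ℕ → ℕ
  χ∣p x with p ∣? x
  ... | yes _ = χ n x
  ... | no  _ = 0

  χ-split : ∀ x → χ n x ≡ χ (p * n) x + χ∣p x
  χ-split x with p ∣? x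
  ... | yes p∣x = cong (_+ χ n x) (sym (indicator-no (λ x⊥p*n → p≢1 (x⊥p*n (p∣x , m∣m*n n))) _))
  ... | no  p∤x = trans (χ-cong (coprime-*ʳ (prime∤⇒coprime pr p∤x)) (coprime-∣ʳ (n∣m*n p)))
                        (sym (+-identityʳ _))

  χ∣p[t*p]≡χ[t] : ∀ t → χ∣p (t * p) ≡ χ n t
  χ∣p[t*p]≡χ[t] t with p ∣? t * p
  ... | yes _   = χ-cong (coprime-∣ˡ (m∣m*n p))
                         (λ t⊥n → coprime-sym (coprime-*ʳ (coprime-sym t⊥n) (prime∤⇒coprime pr p∤n)))
  ... | no  p∤t*p = contradiction (n∣m*n t) p∤t*p

  χ∣p-vanishes : ∀ y → ¬ p ∣ y → χ∣p y ≡ 0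
  χ∣p-vanishes y p∤y with p ∣? y
  ... | yes p∣y = contradiction p∣y p∤y
  ... | no  _   = refl

  ∑χ∣p≡φ[n] : ∑[ j < p * n ] χ∣p (suc j) ≡ φ n
  ∑χ∣p≡φ[n] = begin
    ∑[ j < p * n ] χ∣p (suc j)      ≡⟨ cong (λ N → ∑[ j < N ] χ∣p (suc j)) (*-comm p n) ⟩
    ∑[ j < n * p ] χ∣p (suc j)      ≡⟨ ∑-multiples p n χ∣p χ∣p-vanishes ⟩
    ∑[ t < n ] χ∣p (suc t * p)      ≡⟨ ∑-cong n (χ∣p[t*p]≡χ[t] ∘ suc) ⟩
    ∑[ t < n ] χ n (suc t)          ≡⟨ φ≡∑χ n ⟨
    φ n                             ∎

Smooth : ℕ → ℕ → Set
Smooth b n = ∀ {q} → Prime q → q ∣ n → q ≤ b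

smooth-∣ : ∀ {b d n} → d ∣ n → Smooth b n → Smooth b d
smooth-∣ d∣n smooth pr q∣d = smooth pr (∣-trans q∣d d∣n)

smooth-pred : ∀ {b n} → Smooth (suc b) n → ¬ (Prime (suc b) × suc b ∣ n) → Smooth b n
smooth-pred smooth ¬[pr×∣] {q} pr q∣n with m≤n⇒m<n∨m≡n (smooth pr q∣n)
... | inj₁ q<1+b = ≤-pred q<1+b
... | inj₂ refl  = contradiction (pr , q∣n) ¬[pr×∣]

1-smooth⇒≡1 : ∀ {n} → n > 0 → Smooth 1 n → n ≡ 1
1-smooth⇒≡1 {n} n>0 smooth with factorise n {{>-nonZero n>0}}
... | record { factors = [] ; isFactorisation = n≡1 } = n≡1
... | record { factors = q ∷ qs ; isFactorisation = n≡q*∏qs ; factorsPrime = pr ∷ _ } =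
  contradiction (smooth pr (subst (q ∣_) (sym n≡q*∏qs) (m∣m*n (product qs))))
                (<⇒≱ (nonTrivial⇒n>1 q {{prime⇒nonTrivial pr}}))

record TotientBound (b n : ℕ) : Set where
  constructor totientBound
  field
    r            : ℕ
    r≤b          : r ≤ b
    2^r≤n        : 2 ^ r ≤ n
    n≤φ[n]*[1+r] : n ≤ φ n * suc r

totientBound-≤ : ∀ {b b′ n} → b ≤ b′ → TotientBound b n → TotientBound b′ n
totientBound-≤ b≤b′ (totientBound r r≤b 2^r≤n n≤φ[n]*[1+r]) =
  totientBound r (≤-trans r≤b b≤b′) 2^r≤n n≤φ[n]*[1+r]

totientBound-*-∣ : ∀ {b k} p .{{_ : NonZero p}} → p ∣ k → TotientBound b k → TotientBound b (p * k)
totientBound-*-∣ {k = k} p p∣k (totientBound r r≤b 2^r≤k k≤φ[k]*[1+r]) =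
  totientBound r r≤b (≤-trans 2^r≤k (m≤n*m k p)) (begin
    p * k                ≤⟨ *-monoʳ-≤ p k≤φ[k]*[1+r] ⟩
    p * (φ k * suc r)    ≡⟨ *-assoc p (φ k) (suc r) ⟨
    p * φ k * suc r      ≡⟨ cong (_* suc r) (φ[m*n]≡m*φ[n] p k p∣k) ⟨
    φ (p * k) * suc r    ∎)
  where open ≤-Reasoning

[2+b]*[F*[1+r]]≤[1+b]*F*[2+r] : ∀ b F r → r ≤ b → suc (suc b) * (F * suc r) ≤ suc b * F * suc (suc r)
[2+b]*[F*[1+r]]≤[1+b]*F*[2+r] b F r r≤b = begin
  suc (suc b) * (F * suc r)       ≡⟨ expandˡ b F r ⟩
  suc b * F * suc r + F * suc r   ≤⟨ +-monoʳ-≤ (suc b * F * suc r) (*-monoʳ-≤ F (s≤s r≤b)) ⟩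
  suc b * F * suc r + F * suc b   ≡⟨ expandʳ b F r ⟩
  suc b * F * suc (suc r)         ∎
  where
  open ≤-Reasoning
  expandˡ : ∀ b F r → suc (suc b) * (F * suc r) ≡ suc b * F * suc r + F * suc r
  expandˡ = solve-∀
  expandʳ : ∀ b F r → suc b * F * suc r + F * suc b ≡ suc b * F * suc (suc r)
  expandʳ = solve-∀

totientBound-*-prime : ∀ {b k} → Prime (suc (suc b)) → ¬ suc (suc b) ∣ k →
                       TotientBound b k → TotientBound (suc b) (suc (suc b) * k)
totientBound-*-prime {b} {k} pr p∤k (totientBound r r≤b 2^r≤k k≤φ[k]*[1+r]) =
  totientBound (suc r) (s≤s r≤b) (*-mono-≤ (s≤s (s≤s (z≤n {b}))) 2^r≤k) (begin
    p * k                          ≤⟨ *-monoʳ-≤ p k≤φ[k]*[1+r] ⟩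
    p * (φ k * suc r)              ≤⟨ [2+b]*[F*[1+r]]≤[1+b]*F*[2+r] b (φ k) r r≤b ⟩
    suc b * φ k * suc (suc r)      ≡⟨ cong (_* suc (suc r)) φ[p*k]≡[p-1]*φ[k] ⟨
    φ (p * k) * suc (suc r)        ∎)
  where
  open ≤-Reasoning
  p : ℕ
  p = suc (suc b)
  φ[p*k]≡[p-1]*φ[k] : φ (p * k) ≡ suc b * φ k
  φ[p*k]≡[p-1]*φ[k] = +-cancelʳ-≡ (φ k) _ _
    (trans (φ[p*n]+φ[n]≡p*φ[n] p k pr p∤k) (+-comm (φ k) (suc b * φ k)))

smooth⇒totientBound : ∀ b n → n > 0 → Smooth (suc b) n → TotientBound b n
smooth⇒totientBound zero n n>0 smooth with 1-smooth⇒≡1 n>0 smooth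
... | refl = totientBound 0 z≤n (s≤s z≤n) (s≤s z≤n)
smooth⇒totientBound (suc b) = <-rec (λ n → n > 0 → Smooth (suc (suc b)) n → TotientBound (suc b) n) step
  where
  p : ℕ
  p = suc (suc b)
  step : ∀ n → (∀ {m} → m < n → m > 0 → Smooth p m → TotientBound (suc b) m) →
         n > 0 → Smooth p n → TotientBound (suc b) n
  step n rec n>0 smooth with prime? p ×-dec p ∣? n
  ... | no ¬[pr×∣] = totientBound-≤ (n≤1+n b) (smooth⇒totientBound b n n>0 (smooth-pred smooth ¬[pr×∣]))
  ... | yes (pr , divides k refl) = subst (TotientBound (suc b)) (*-comm p k) (pk-bound (p ∣? k))
    where
    instance
      k≢0 : NonZero k
      k≢0 = m*n≢0⇒m≢0 k {{>-nonZero n>0}}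
    k>0 : k > 0
    k>0 = >-nonZero⁻¹ k
    smooth-k : Smooth p k
    smooth-k = smooth-∣ (m∣m*n p) smooth
    pk-bound : Dec (p ∣ k) → TotientBound (suc b) (p * k)
    pk-bound (yes p∣k) = totientBound-*-∣ p p∣k (rec (m<m*n k p (s≤s (s≤s z≤n))) k>0 smooth-k)
    pk-bound (no  p∤k) = totientBound-*-prime pr p∤k
                           (smooth⇒totientBound b k k>0 (smooth-pred smooth-k (λ (_ , p∣k) → p∤k p∣k)))

lemma1p4p2 : (n : ℕ) → n > 0 → n ≤ φ n * (⌊log₂ n ⌋ + 1)
lemma1p4p2 n n>0 = ≤-trans n≤φ[n]*[1+r] (*-monoʳ-≤ (φ n) 1+r≤log₂n+1)
  where
  open TotientBound (smooth⇒totientBound n n n>0 (λ _ q∣n → m≤n⇒m≤1+n (∣⇒≤ {{>-nonZero n>0}} q∣n)))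
  r≤log₂n : r ≤ ⌊log₂ n ⌋
  r≤log₂n = subst (_≤ ⌊log₂ n ⌋) (⌊log₂[2^n]⌋≡n r) (⌊log₂⌋-mono-≤ 2^r≤n)
  1+r≤log₂n+1 : suc r ≤ ⌊log₂ n ⌋ + 1
  1+r≤log₂n+1 = subst (suc r ≤_) (+-comm 1 ⌊log₂ n ⌋) (s≤s r≤log₂n)
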